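{- Let $q$ be a power of an odd prime with $q\equiv 1\pmod 3$, let $R$ be the graph defined below over $\mathbb F_q$, and let $\phi$ be an automorphism of $R$ with associated function $\lambda_2$ such that $\lambda_2(a)=a$ for all $a\in\mathbb F_q$. Then for all $x,y,z\in\mathbb F_q$, the first component of $\phi([x,y,z])$ is $x$ and the first component of $\phi((x,y,z))$ is $x$.
   Context: $R$ is the bipartite graph whose parts are the set of points $(p_1,p_2,p_3)\in\mathbb F_q^3$ and the set of lines $[l_1,l_2,l_3]\in\mathbb F_q^3$ (two disjoint copies of $\mathbb F_q^3$), where $(p_1,p_2,p_3)$ is adjacent to $[l_1,l_2,l_3]$ if and only if $p_2+l_2 = p_1l_1$ and $p_3+l_3 = p_1p_2l_1(p_1+p_2+p_1p_2)$. For such $q$, every automorphism $\phi$ of $R$ maps points to points and lines to lines, and there are functions $\lambda_1:\mathbb F_q^3\to\mathbb F_q$ and $\lambda_2,\lambda_3:\mathbb F_q\to\mathbb F_q$ (depending on $\phi$) with $\phi([x,y,z])=[\lambda_1(x,y,z),\lambda_2(y),\lambda_3(z)]$ for all $x,y,z\in\mathbb F_q$. -}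

module Defs where

open import Level using (0ℓ)
open import Data.Nat using (ℕ; _^_; _%_; _≥_)
open import Data.Nat.Primality using (Prime)
open import Data.Fin using (Fin)
open import Data.Product using (_×_; _,_; ∃; ∃-syntax; Σ-syntax)
open import Data.Sum using (_⊎_; inj₁; inj₂)
open import Data.Empty using (⊥)
open import Relation.Nullary using (¬_)
open import Relation.Binary.PropositionalEquality using (_≡_)
open import Algebra.Structures using (IsCommutativeRing)
open import Function.Bundles using (_↔_; _⇔_; Inverse)

OddPrimePower : ℕ → Set
OddPrimePower q = ∃[ p ] ∃[ k ] (Prime p × p % 2 ≡ 1 × k ≥ 1 × q ≡ p ^ k)

record FiniteField (q : ℕ) : Set₁ where
  infixl 7 _*_
  infixl 6 _+_
  field
    F   : Set
    _+_ : F → F → F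
    _*_ : F → F → F
    -_  : F → F
    0#  : F
    1#  : F
    isCommutativeRing : IsCommutativeRing _≡_ _+_ _*_ -_ 0# 1#
    0≢1     : ¬ (0# ≡ 1#)
    inverse : ∀ x → ¬ (x ≡ 0#) → ∃[ y ] (x * y ≡ 1#)
    enum    : Fin q ↔ F

module Graph {q : ℕ} (𝔽 : FiniteField q) where
  open FiniteField 𝔽

  Point : Set
  Point = F × F × F

  Line : Set
  Line = F × F × F

  Incident : Point → Line → Set
  Incident (p₁ , p₂ , p₃) (l₁ , l₂ , l₃) =
    (p₂ + l₂ ≡ p₁ * l₁) × (p₃ + l₃ ≡ p₁ * p₂ * l₁ * (p₁ + p₂ + p₁ * p₂))

  Vertex : Set
  Vertex = Point ⊎ Line

  Adj : Vertex → Vertex → Set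
  Adj (inj₁ p) (inj₂ l) = Incident p l
  Adj (inj₂ l) (inj₁ p) = Incident p l
  Adj (inj₁ _) (inj₁ _) = ⊥
  Adj (inj₂ _) (inj₂ _) = ⊥

  record Automorphism : Set where
    field
      bij      : Vertex ↔ Vertex
      preserve : ∀ u v → Adj u v ⇔ Adj (Inverse.to bij u) (Inverse.to bij v)

  open Automorphism public

  apply : Automorphism → Vertex → Vertex
  apply φ = Inverse.to (bij φ)

{-# OPTIONS --safe #-}
module Submission where

-- φ maps points to points; write A p, B p for the first two coordinates of φ p. An incidence
-- p ~ [x, y, z] gives B p + y = A p · Λ(x, y, z), and φ is injective. The points
-- R σ = (σ, 0, - z) lie on [0, 0, z] and on every [t, σ t, z]; comparing these incidences
-- forces Λ(0, 0, z) = 0 and B (R σ) = 0, so σ t = A (R σ) · Λ(t, σ t, z). For p₂ ∉ {0, - 1} and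
-- s = - p₂ / (1 + p₂), the point (s, p₂, - z) lies on all lines [t, s t - p₂, z], which share
-- their third coordinate and each meet some R σ; this pins φ (s, p₂, - z) to (s, p₂, _) and
-- yields A (R σ) = σ, hence Λ(x, y, z) = x whenever x y ≠ 0. Then φ fixes the first two
-- coordinates of every point with nonzero coordinates, and the remaining lines and points are
-- reached through such points.

open import Defs
open import Data.Nat using (ℕ; _%_)
open import Data.Product using (_×_; _,_; ∃-syntax; proj₁)
open import Data.Sum using (inj₁; inj₂)
open import Relation.Binary.PropositionalEquality using (_≡_)

open import Algebra.Bundles using (CommutativeRing)
open import Algebra.Solver.Ring.AlmostCommutativeRing
  using (fromCommutativeRing; _-Raw-AlmostCommutative⟶_)
open import Data.Empty using (⊥-elim)
open import Data.Fin.Base using (Fin; _<_)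
open import Data.Fin.Properties using (pigeonhole; inj⇒≟; any?; <-irrefl)
import Data.Fin.Base as Fin
open import Data.Integer.Base as ℤ using (ℤ; 0ℤ; 1ℤ)
import Data.Integer.Properties as ℤ
open import Data.Maybe.Base using (Maybe; just; nothing)
open import Data.Nat.Base as ℕ using (zero; suc; z≤n; s≤s)
import Data.Nat.Properties as ℕ
open import Data.Nat.Primality using (Prime; ¬prime[0]; ¬prime[1])
open import Data.Product using (∃₂; proj₂)
open import Data.Sign.Base as Sign using (Sign)
open import Data.Sum.Properties using (inj₁-injective; inj₂-injective)
open import Data.Vec.Functional using ([]; _∷_)
open import Function.Base using (_∘_)
open import Function.Bundles using (Injection; Inverse; Equivalence)
open import Function.Definitions using (Injective)
open import Function.Properties.Inverse using (↔⇒↣; ↔-sym)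
open import Level using (Level; 0ℓ)
open import Relation.Binary.Definitions using (DecidableEquality)
import Relation.Binary.PropositionalEquality as ≡
open ≡ using (_≢_; refl; sym; trans; cong; cong₂; subst; subst₂; module ≡-Reasoning)
open import Relation.Nullary using (¬_; Dec; yes; no; ¬?; contradiction)
open import Relation.Nullary.Decidable using (decidable-stable)

-- The library's ring solver needs coefficients whose equality computes, and natural-number
-- coefficients cannot express subtraction; so integers are used, mapped into R along ι.
module IntegerCoefficients {a ℓ : Level} (R : CommutativeRing a ℓ) where

  open import Data.Integer.Base using (+_; -[1+_]; _⊖_; _◃_; sign; ∣_∣)

  open CommutativeRing R renaming (refl to ≈-refl; sym to ≈-sym; trans to ≈-trans)
  open import Algebra.Properties.Ring ring using (-‿involutive; -0#≈0#; -‿+-comm; -1*x≈-x)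
  open import Algebra.Properties.Semiring.Mult.TCOptimised semiring using (×-homo-+; ×1-homo-*) renaming (_×_ to _×′_)
  open import Algebra.Solver.Ring.NaturalCoefficients.Default commutativeSemiring
    using (solve; _:+_; _:*_; _:=_)
  open import Relation.Binary.Reasoning.Setoid setoid

  -- With the optimised multiple, ι 0ℤ and ι 1ℤ are definitionally 0# and 1#.
  ι : ℤ → Carrier
  ι (+ n)    = n ×′ 1#
  ι -[1+ n ] = - (suc n ×′ 1#)

  private
    [x+y]-[x+z]≈y-z : ∀ x y z → (x + y) - (x + z) ≈ y - z
    [x+y]-[x+z]≈y-z x y z = begin
      (x + y) - (x + z)         ≈⟨ +-congˡ (-‿+-comm x z) ⟨
      (x + y) + (- x + - z)     ≈⟨ solve 4 (λ x y x' z' → (x :+ y) :+ (x' :+ z') := (x :+ x') :+ (y :+ z'))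
                                           ≈-refl x y (- x) (- z) ⟩
      (x - x) + (y - z)         ≈⟨ +-congʳ (-‿inverseʳ x) ⟩
      0# + (y - z)              ≈⟨ +-identityˡ (y - z) ⟩
      y - z                     ∎

  ι-⊖ : ∀ k l → ι (k ⊖ l) ≈ k ×′ 1# - l ×′ 1#
  ι-⊖ k       zero    = ≈-sym (≈-trans (+-congˡ -0#≈0#) (+-identityʳ (k ×′ 1#)))
  ι-⊖ zero    (suc l) = ≈-sym (+-identityˡ _)
  ι-⊖ (suc k) (suc l) = begin
    ι (suc k ⊖ suc l)                  ≡⟨ ≡.cong ι (ℤ.[1+m]⊖[1+n]≡m⊖n k l) ⟩
    ι (k ⊖ l)                          ≈⟨ ι-⊖ k l ⟩
    k ×′ 1# - l ×′ 1#                  ≈⟨ [x+y]-[x+z]≈y-z 1# (k ×′ 1#) (l ×′ 1#) ⟨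
    (1# + k ×′ 1#) - (1# + l ×′ 1#)    ≈⟨ +-cong (×-homo-+ 1# 1 k) (-‿cong (×-homo-+ 1# 1 l)) ⟨
    suc k ×′ 1# - suc l ×′ 1#          ∎

  ι-+ : ∀ i j → ι (i ℤ.+ j) ≈ ι i + ι j
  ι-+ -[1+ k ] -[1+ l ] = begin
    - (suc (suc (k ℕ.+ l)) ×′ 1#)      ≡⟨ ≡.cong (λ m → - (suc m ×′ 1#)) (ℕ.+-suc k l) ⟨
    - ((suc k ℕ.+ suc l) ×′ 1#)        ≈⟨ -‿cong (×-homo-+ 1# (suc k) (suc l)) ⟩
    - (suc k ×′ 1# + suc l ×′ 1#)      ≈⟨ -‿+-comm _ _ ⟨
    - (suc k ×′ 1#) + - (suc l ×′ 1#)  ∎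
  ι-+ -[1+ k ] (+ l)    = ≈-trans (ι-⊖ l (suc k)) (+-comm _ _)
  ι-+ (+ k)    -[1+ l ] = ι-⊖ k (suc l)
  ι-+ (+ k)    (+ l)    = ×-homo-+ 1# k l

  ι-neg : ∀ i → ι (ℤ.- i) ≈ - ι i
  ι-neg (+ zero)   = ≈-sym -0#≈0#
  ι-neg (+ suc k)  = ≈-refl
  ι-neg -[1+ k ]   = ≈-sym (-‿involutive _)

  private
    ισ : Sign → Carrier
    ισ Sign.+ = 1#
    ισ Sign.- = - 1#

    ισ-* : ∀ s t → ισ (s Sign.* t) ≈ ισ s * ισ t
    ισ-* Sign.+ t      = ≈-sym (*-identityˡ _)
    ισ-* Sign.- Sign.+ = ≈-sym (*-identityʳ _)
    ισ-* Sign.- Sign.- = ≈-sym (≈-trans (-1*x≈-x _) (-‿involutive _))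

    ι-◃ : ∀ s k → ι (s ◃ k) ≈ ισ s * k ×′ 1#
    ι-◃ s      zero    = ≈-sym (zeroʳ _)
    ι-◃ Sign.+ (suc k) = ≈-sym (*-identityˡ _)
    ι-◃ Sign.- (suc k) = ≈-sym (-1*x≈-x _)

    ι-sign-abs : ∀ i → ι i ≈ ισ (sign i) * ∣ i ∣ ×′ 1#
    ι-sign-abs i = ≈-trans (reflexive (≡.cong ι (≡.sym (ℤ.◃-inverse i)))) (ι-◃ (sign i) ∣ i ∣)

  ι-* : ∀ i j → ι (i ℤ.* j) ≈ ι i * ι j
  ι-* i j = begin
    ι (i ℤ.* j)                                          ≈⟨ ι-◃ (sign i Sign.* sign j) (∣ i ∣ ℕ.* ∣ j ∣) ⟩
    ισ (sign i Sign.* sign j) * (∣ i ∣ ℕ.* ∣ j ∣) ×′ 1#  ≈⟨ *-cong (ισ-* (sign i) (sign j)) (×1-homo-* ∣ i ∣ ∣ j ∣) ⟩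
    (σi * σj) * (ai * aj)                                ≈⟨ solve 4 (λ a b c d → (a :* b) :* (c :* d) := (a :* c) :* (b :* d)) ≈-refl σi σj ai aj ⟩
    (σi * ai) * (σj * aj)                                ≈⟨ *-cong (ι-sign-abs i) (ι-sign-abs j) ⟨
    ι i * ι j                                            ∎
    where
    σi = ισ (sign i)
    σj = ισ (sign j)
    ai = ∣ i ∣ ×′ 1#
    aj = ∣ j ∣ ×′ 1#

  ℤ⟶R : ℤ.+-*-rawRing -Raw-AlmostCommutative⟶ fromCommutativeRing R
  ℤ⟶R = record
    { ⟦_⟧ = ι ; +-homo = ι-+ ; *-homo = ι-* ; -‿homo = ι-neg ; 0-homo = ≈-refl ; 1-homo = ≈-refl }

  private
    ι-≟ : ∀ i j → Maybe (ι i ≈ ι j)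
    ι-≟ i j with i ℤ.≟ j
    ... | yes ≡.refl = just ≈-refl
    ... | no _       = nothing

  open import Algebra.Solver.Ring ℤ.+-*-rawRing (fromCommutativeRing R) ℤ⟶R ι-≟ public


module _ {a : Level} {A : Set a} (_≟_ : DecidableEquality A) where

  ∃-avoiding : ∀ {m n} → m ℕ.< n → (f : Fin n → A) → Injective _≡_ _≡_ f →
               (g : Fin m → A) → ∃[ i ] ∀ j → f i ≢ g j
  ∃-avoiding m<n f f-inj g with any? (λ i → ¬? (any? (λ j → f i ≟ g j)))
  ... | yes (i , misses) = i , λ j hit → misses (j , hit)
  ... | no none = contradiction (pigeonhole m<n (proj₁ ∘ hits)) collision
    where
    hits : ∀ i → ∃[ j ] f i ≡ g j
    hits i = decidable-stable (any? (λ j → f i ≟ g j)) (λ misses → none (i , misses))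
    collision : ¬ ∃₂ λ i i' → i < i' × proj₁ (hits i) ≡ proj₁ (hits i')
    collision (i , i' , i<i' , same) =
      <-irrefl (f-inj (trans (proj₂ (hits i)) (trans (cong g same) (sym (proj₂ (hits i')))))) i<i'

module FieldLemmas {q : ℕ} (𝔽 : FiniteField q) where
  open FiniteField 𝔽

  ring : CommutativeRing 0ℓ 0ℓ
  ring = record { isCommutativeRing = isCommutativeRing }

  open CommutativeRing ring public using (_-_; *-comm; *-assoc; zeroˡ; zeroʳ; +-identityˡ; +-identityʳ; *-identityʳ)
  open IntegerCoefficients ring public using (solve; _:=_; _:+_; _:-_; _:*_; :-_; con)
  open import Algebra.Properties.Group (CommutativeRing.+-group ring) using (x∙y⁻¹≈ε⇒x≈y; x≈y⇒x∙y⁻¹≈ε)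
  open import Algebra.Properties.Group (CommutativeRing.+-group ring) public
    using () renaming (∙-cancelˡ to +-cancelˡ; ∙-cancelʳ to +-cancelʳ)
  open import Algebra.Properties.Ring (CommutativeRing.ring ring) public using (-‿involutive)

  1≢0 : 1# ≢ 0#
  1≢0 = 0≢1 ∘ sym

  _≟_ : DecidableEquality F
  _≟_ = inj⇒≟ (↔⇒↣ (↔-sym enum))

  inv : (x : F) → x ≢ 0# → F
  inv x x≢0 = proj₁ (inverse x x≢0)

  x*inv≡1 : ∀ x (x≢0 : x ≢ 0#) → x * inv x x≢0 ≡ 1#
  x*inv≡1 x x≢0 = proj₂ (inverse x x≢0)

  divide : F → (x : F) → x ≢ 0# → F
  divide y x x≢0 = y * inv x x≢0

  divide-* : ∀ y x (x≢0 : x ≢ 0#) → divide y x x≢0 * x ≡ y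
  divide-* y x x≢0 = begin
    y * inv x x≢0 * x      ≡⟨ solve 3 (λ y x x⁻¹ → y :* x⁻¹ :* x := y :* (x :* x⁻¹)) refl y x (inv x x≢0) ⟩
    y * (x * inv x x≢0)    ≡⟨ cong (y *_) (x*inv≡1 x x≢0) ⟩
    y * 1#                 ≡⟨ *-identityʳ y ⟩
    y                      ∎
    where open ≡-Reasoning

  *-divide : ∀ y x (x≢0 : x ≢ 0#) → x * divide y x x≢0 ≡ y
  *-divide y x x≢0 = trans (*-comm x _) (divide-* y x x≢0)

  x-y≡0⇒x≡y : ∀ {x y} → x - y ≡ 0# → x ≡ y
  x-y≡0⇒x≡y = x∙y⁻¹≈ε⇒x≈y _ _

  x≡y⇒x-y≡0 : ∀ {x y} → x ≡ y → x - y ≡ 0#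
  x≡y⇒x-y≡0 = x≈y⇒x∙y⁻¹≈ε

  linearCombination₁ : ∀ {x y l r} c → x - y ≡ c * (l - r) → l ≡ r → x ≡ y
  linearCombination₁ c x-y≡ l≡r = x-y≡0⇒x≡y (trans x-y≡ (trans (cong (c *_) (x≡y⇒x-y≡0 l≡r)) (zeroʳ c)))

  linearCombination₂ : ∀ {x y l r l' r'} c c' → x - y ≡ c * (l - r) + c' * (l' - r') →
                       l ≡ r → l' ≡ r' → x ≡ y
  linearCombination₂ c c' x-y≡ l≡r l'≡r' = x-y≡0⇒x≡y (begin
    _                                  ≡⟨ x-y≡ ⟩
    c * (_ - _) + c' * (_ - _)         ≡⟨ cong₂ (λ d d' → c * d + c' * d') (x≡y⇒x-y≡0 l≡r) (x≡y⇒x-y≡0 l'≡r') ⟩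
    c * 0# + c' * 0#                   ≡⟨ solve 2 (λ c c' → c :* con 0ℤ :+ c' :* con 0ℤ := con 0ℤ) refl c c' ⟩
    0#                                 ∎)
    where open ≡-Reasoning

  x*y≡0⇒y≡0 : ∀ {x y} → x ≢ 0# → x * y ≡ 0# → y ≡ 0#
  x*y≡0⇒y≡0 {x} {y} x≢0 xy≡0 = linearCombination₂ (inv x x≢0) (- y)
    (solve 3 (λ x y x⁻¹ → y :- con 0ℤ := x⁻¹ :* (x :* y :- con 0ℤ) :+ (:- y) :* (x :* x⁻¹ :- con 1ℤ))
      refl x y (inv x x≢0))
    xy≡0 (x*inv≡1 x x≢0)

  *-nonzero : ∀ {x y} → x ≢ 0# → y ≢ 0# → x * y ≢ 0#
  *-nonzero x≢0 y≢0 = y≢0 ∘ x*y≡0⇒y≡0 x≢0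

  x*y≢0⇒x≢0 : ∀ {x y} → x * y ≢ 0# → x ≢ 0#
  x*y≢0⇒x≢0 {y = y} xy≢0 refl = xy≢0 (zeroˡ y)

  x*y≢0⇒y≢0 : ∀ {x y} → x * y ≢ 0# → y ≢ 0#
  x*y≢0⇒y≢0 {x} xy≢0 refl = xy≢0 (zeroʳ x)

  -x≡0⇒x≡0 : ∀ {x} → - x ≡ 0# → x ≡ 0#
  -x≡0⇒x≡0 {x} = linearCombination₁ (- 1#) (solve 1 (λ x → x :- con 0ℤ := (:- con 1ℤ) :* (:- x :- con 0ℤ)) refl x)

  x≢y⇒x-y≢0 : ∀ {x y} → x ≢ y → x - y ≢ 0#
  x≢y⇒x-y≢0 x≢y = x≢y ∘ x-y≡0⇒x≡y

  y+[x-y]≡x : ∀ x y → y + (x - y) ≡ x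
  y+[x-y]≡x = solve 2 (λ x y → y :+ (x :- y) := x) refl

  [x-y]+y≡x : ∀ x y → (x - y) + y ≡ x
  [x-y]+y≡x = solve 2 (λ x y → (x :- y) :+ y := x) refl

  *-cancelˡ : ∀ {x y z} → x ≢ 0# → x * y ≡ x * z → y ≡ z
  *-cancelˡ {x} {y} {z} x≢0 xy≡xz = x-y≡0⇒x≡y (x*y≡0⇒y≡0 x≢0
    (trans (solve 3 (λ x y z → x :* (y :- z) := x :* y :- x :* z) refl x y z) (x≡y⇒x-y≡0 xy≡xz)))

  *-cancelʳ : ∀ {x y z} → x ≢ 0# → y * x ≡ z * x → y ≡ z
  *-cancelʳ {x} {y} {z} x≢0 yx≡zx = *-cancelˡ x≢0 (trans (*-comm x y) (trans yx≡zx (*-comm z x)))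

  1+x≢0 : ∀ {x} → x ≢ - 1# → 1# + x ≢ 0#
  1+x≢0 {x} x≢-1 1+x≡0 = x≢-1 (linearCombination₁ 1#
    (solve 1 (λ x → x :- (:- con 1ℤ) := con 1ℤ :* ((con 1ℤ :+ x) :- con 0ℤ)) refl x) 1+x≡0)

  x*[1+y]≡-y-injective : ∀ {x y y'} → x * (1# + y) ≡ - y → x * (1# + y') ≡ - y' → y ≡ y'
  x*[1+y]≡-y-injective {x} {y} {y'} eq eq' = x-y≡0⇒x≡y (x*y≡0⇒y≡0 x+1≢0 (linearCombination₂ 1# (- 1#)
      (solve 3 (λ x y y' → (x :+ con 1ℤ) :* (y :- y') :- con 0ℤ :=
        con 1ℤ :* (x :* (con 1ℤ :+ y) :- :- y) :+ (:- con 1ℤ) :* (x :* (con 1ℤ :+ y') :- :- y')) refl x y y')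
      eq eq'))
    where
    x+1≢0 : x + 1# ≢ 0#
    x+1≢0 x+1≡0 = 1≢0 (linearCombination₂ (- 1#) (1# + y)
      (solve 2 (λ x y → con 1ℤ :- con 0ℤ :=
        (:- con 1ℤ) :* (x :* (con 1ℤ :+ y) :- :- y) :+ (con 1ℤ :+ y) :* ((x :+ con 1ℤ) :- con 0ℤ)) refl x y)
      eq x+1≡0)

  record TwoAvoiding (c c' : F) : Set where
    field
      d₁ d₂ : F
      d₁≢d₂ : d₁ ≢ d₂
      d₁≢c  : d₁ ≢ c
      d₁≢c' : d₁ ≢ c'
      d₂≢c  : d₂ ≢ c
      d₂≢c' : d₂ ≢ c'

  module _ (3<q : 3 ℕ.< q) where

    ∃-avoiding₃ : ∀ c₁ c₂ c₃ → ∃[ d ] d ≢ c₁ × d ≢ c₂ × d ≢ c₃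
    ∃-avoiding₃ c₁ c₂ c₃ with ∃-avoiding _≟_ 3<q (Inverse.to enum) (Injection.injective (↔⇒↣ enum))
                                 (c₁ ∷ c₂ ∷ c₃ ∷ [])
    ... | i , avoids =
      Inverse.to enum i , avoids Fin.zero , avoids (Fin.suc Fin.zero) , avoids (Fin.suc (Fin.suc Fin.zero))

    twoAvoiding : ∀ c c' → TwoAvoiding c c'
    twoAvoiding c c' with ∃-avoiding₃ c c' c'
    ... | d₁ , d₁≢c , d₁≢c' , _ with ∃-avoiding₃ c c' d₁
    ... | d₂ , d₂≢c , d₂≢c' , d₂≢d₁ = record
      { d₁ = d₁ ; d₂ = d₂ ; d₁≢d₂ = d₂≢d₁ ∘ sym
      ; d₁≢c = d₁≢c ; d₁≢c' = d₁≢c' ; d₂≢c = d₂≢c ; d₂≢c' = d₂≢c' }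

module Incidence {q : ℕ} (𝔽 : FiniteField q) where
  open FiniteField 𝔽
  open FieldLemmas 𝔽
  open Graph 𝔽

  lineThrough : Point → F → Line
  lineThrough (p₁ , p₂ , p₃) t = t , p₁ * t - p₂ , p₁ * p₂ * t * (p₁ + p₂ + p₁ * p₂) - p₃

  lineThrough-incident : ∀ P t → Incident P (lineThrough P t)
  lineThrough-incident (p₁ , p₂ , p₃) t = y+[x-y]≡x _ p₂ , y+[x-y]≡x _ p₃

  pointOn : Line → F → Point
  pointOn (l₁ , l₂ , l₃) p = p , p₂ , p * p₂ * l₁ * (p + p₂ + p * p₂) - l₃
    where p₂ = p * l₁ - l₂

  pointOn-incident : ∀ L p → Incident (pointOn L p) L
  pointOn-incident (l₁ , l₂ , l₃) p = [x-y]+y≡x _ l₂ , [x-y]+y≡x _ l₃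

  pointsOnLine-≡ : ∀ {P Q L} → Incident P L → Incident Q L → proj₁ P ≡ proj₁ Q → P ≡ Q
  pointsOnLine-≡ {a , b , c} {.a , b' , c'} {x , y , z} (P~L₁ , P~L₂) (Q~L₁ , Q~L₂) refl =
    cong (a ,_) (cong₂ _,_ b≡b'
      (+-cancelʳ z c c' (trans P~L₂ (trans (cong (λ v → a * v * x * (a + v + a * v)) b≡b') (sym Q~L₂)))))
    where
    b≡b' : b ≡ b'
    b≡b' = +-cancelʳ y b b' (trans P~L₁ (sym Q~L₁))

  linesThroughPoint-≡ : ∀ {P L M} → Incident P L → Incident P M → proj₁ L ≡ proj₁ M → L ≡ M
  linesThroughPoint-≡ {a , b , c} {x , y , z} {.x , y' , z'} (P~L₁ , P~L₂) (P~M₁ , P~M₂) refl =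
    cong (x ,_) (cong₂ _,_ (+-cancelˡ b y y' (trans P~L₁ (sym P~M₁))) (+-cancelˡ c z z' (trans P~L₂ (sym P~M₂))))

  sharedPoint-equal-z : ∀ {a b c l₀ y₀ l₁ y₁ w} →
    Incident (a , b , c) (l₀ , y₀ , w) → Incident (a , b , c) (l₁ , y₁ , w) → y₀ ≢ y₁ →
    a ≢ 0# × b * (a + b + a * b) ≡ 0#
  sharedPoint-equal-z {a} {b} {c} {l₀} {y₀} {l₁} {y₁} {w} (first₀ , second₀) (first₁ , second₁) y₀≢y₁ =
    a≢0 , x*y≡0⇒y≡0 a≢0 (trans (sym (*-assoc a b h)) (x*y≡0⇒y≡0 l₁-l₀≢0 [l₁-l₀]*[a*b*h]≡0))
    where
    h = a + b + a * b
    a*[l₁-l₀]≡y₁-y₀ : a * (l₁ - l₀) ≡ y₁ - y₀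
    a*[l₁-l₀]≡y₁-y₀ = linearCombination₂ (- 1#) 1#
      (solve 6 (λ a b l₀ l₁ y₀ y₁ → a :* (l₁ :- l₀) :- (y₁ :- y₀) :=
        (:- con 1ℤ) :* ((b :+ y₁) :- a :* l₁) :+ con 1ℤ :* ((b :+ y₀) :- a :* l₀)) refl a b l₀ l₁ y₀ y₁)
      first₁ first₀
    a*[l₁-l₀]≢0 : a * (l₁ - l₀) ≢ 0#
    a*[l₁-l₀]≢0 = subst (_≢ 0#) (sym a*[l₁-l₀]≡y₁-y₀) (x≢y⇒x-y≢0 (y₀≢y₁ ∘ sym))
    a≢0 = x*y≢0⇒x≢0 a*[l₁-l₀]≢0
    l₁-l₀≢0 = x*y≢0⇒y≢0 a*[l₁-l₀]≢0
    [l₁-l₀]*[a*b*h]≡0 : (l₁ - l₀) * (a * b * h) ≡ 0#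
    [l₁-l₀]*[a*b*h]≡0 = linearCombination₂ (- 1#) 1#
      (solve 6 (λ m h c w l₀ l₁ → (l₁ :- l₀) :* (m :* h) :- con 0ℤ :=
        (:- con 1ℤ) :* ((c :+ w) :- m :* l₁ :* h) :+ con 1ℤ :* ((c :+ w) :- m :* l₀ :* h)) refl (a * b) h c w l₀ l₁)
      second₁ second₀

module Rigidity {q : ℕ} (𝔽 : FiniteField q) (3<q : 3 ℕ.< q) (φ : Graph.Automorphism 𝔽)
  (Λ : FiniteField.F 𝔽 → FiniteField.F 𝔽 → FiniteField.F 𝔽 → FiniteField.F 𝔽)
  (λ₃ : FiniteField.F 𝔽 → FiniteField.F 𝔽)
  (φ-line : ∀ x y z → Graph.apply 𝔽 φ (inj₂ (x , y , z)) ≡ inj₂ (Λ x y z , y , λ₃ z)) where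

  open FiniteField 𝔽
  open FieldLemmas 𝔽
  open Graph 𝔽
  open Incidence 𝔽

  φ-injective : ∀ {u v} → apply φ u ≡ apply φ v → u ≡ v
  φ-injective = Injection.injective (↔⇒↣ (bij φ))

  φ-adjacent : ∀ u v → Adj u v → Adj (apply φ u) (apply φ v)
  φ-adjacent u v = Equivalence.to (preserve φ u v)

  φ-point : ∀ P → ∃[ P' ] apply φ (inj₁ P) ≡ inj₁ P'
  φ-point P with apply φ (inj₁ P) in φP≡
  ... | inj₁ P' = P' , refl
  ... | inj₂ _  = ⊥-elim (subst₂ Adj φP≡ (φ-line _ _ _)
                    (φ-adjacent (inj₁ P) (inj₂ (lineThrough P 0#)) (lineThrough-incident P 0#)))

  φᴾ : Point → Point
  φᴾ P = proj₁ (φ-point P)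

  A B : Point → F
  A P = proj₁ (φᴾ P)
  B P = proj₁ (proj₂ (φᴾ P))

  φᴸ : Line → Line
  φᴸ (x , y , z) = Λ x y z , y , λ₃ z

  φ-incident : ∀ {P L} → Incident P L → Incident (φᴾ P) (φᴸ L)
  φ-incident {P} {x , y , z} P~L =
    subst₂ Adj (proj₂ (φ-point P)) (φ-line x y z) (φ-adjacent (inj₁ P) (inj₂ (x , y , z)) P~L)

  B+y≡A*Λ : ∀ {P x y z} → Incident P (x , y , z) → B P + y ≡ A P * Λ x y z
  B+y≡A*Λ = proj₁ ∘ φ-incident

  A-injectiveOnLine : ∀ {P Q L} → Incident P L → Incident Q L → A P ≡ A Q → P ≡ Q
  A-injectiveOnLine {P} {Q} P~L Q~L A≡ = inj₁-injective (φ-injective (begin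
    apply φ (inj₁ P)   ≡⟨ proj₂ (φ-point P) ⟩
    inj₁ (φᴾ P)        ≡⟨ cong inj₁ (pointsOnLine-≡ (φ-incident P~L) (φ-incident Q~L) A≡) ⟩
    inj₁ (φᴾ Q)        ≡⟨ proj₂ (φ-point Q) ⟨
    apply φ (inj₁ Q)   ∎))
    where open ≡-Reasoning

  Λ-injectiveThroughPoint : ∀ {P x y z x' y' z'} → Incident P (x , y , z) → Incident P (x' , y' , z') →
                            Λ x y z ≡ Λ x' y' z' → (x , y , z) ≡ (x' , y' , z')
  Λ-injectiveThroughPoint {P} {x} {y} {z} {x'} {y'} {z'} P~L P~M Λ≡ = inj₂-injective (φ-injective (begin
    apply φ (inj₂ (x , y , z))       ≡⟨ φ-line x y z ⟩
    inj₂ (φᴸ (x , y , z))            ≡⟨ cong inj₂ (linesThroughPoint-≡ (φ-incident P~L) (φ-incident P~M) Λ≡) ⟩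
    inj₂ (φᴸ (x' , y' , z'))         ≡⟨ φ-line x' y' z' ⟨
    apply φ (inj₂ (x' , y' , z'))    ∎))
    where open ≡-Reasoning

  -- All lines through (0, p₂, p₃) agree in their last two coordinates.
  A-firstZero : ∀ p₂ p₃ → A (0# , p₂ , p₃) ≡ 0#
  A-firstZero p₂ p₃ = decidable-stable (A P ≟ 0#) λ A≢0 →
    0≢1 (cong proj₁ (Λ-injectiveThroughPoint (L~P 0#) (L~P 1#) (*-cancelˡ A≢0
      (trans (sym (B+y≡A*Λ (L~P 0#))) (trans (cong (B P +_) y₀≡y₁) (B+y≡A*Λ (L~P 1#)))))))
    where
    P = 0# , p₂ , p₃
    L~P = lineThrough-incident P
    y₀≡y₁ : 0# * 0# - p₂ ≡ 0# * 1# - p₂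
    y₀≡y₁ = cong (_- p₂) (trans (zeroˡ 0#) (sym (zeroˡ 1#)))

  module Column (z : F) where

    R : F → Point
    R σ = σ , 0# , - z

    Z : Line
    Z = 0# , 0# , z

    R~line : ∀ {σ t y} → σ * t ≡ y → Incident (R σ) (t , y , z)
    R~line {σ} {t} {y} σt≡y =
      trans (+-identityˡ y) (sym σt≡y) ,
      solve 3 (λ σ t z → :- z :+ z := σ :* con 0ℤ :* t :* (σ :+ con 0ℤ :+ σ :* con 0ℤ)) refl σ t z

    R~Z : ∀ σ → Incident (R σ) Z
    R~Z σ = R~line (zeroʳ σ)

    A-R-injective : ∀ {σ σ'} → A (R σ) ≡ A (R σ') → σ ≡ σ'
    A-R-injective = cong proj₁ ∘ A-injectiveOnLine (R~Z _) (R~Z _)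

    A-R≢0×B-R*h≡0 : ∀ {σ} → σ ≢ 0# →
      A (R σ) ≢ 0# × B (R σ) * (A (R σ) + B (R σ) + A (R σ) * B (R σ)) ≡ 0#
    A-R≢0×B-R*h≡0 {σ} σ≢0 = sharedPoint-equal-z (φ-incident (R~line {σ} {0#} refl)) (φ-incident (R~line {σ} {1#} refl))
      λ σ*0≡σ*1 → σ≢0 (linearCombination₁ (- 1#)
        (solve 1 (λ σ → σ :- con 0ℤ := (:- con 1ℤ) :* (σ :* con 0ℤ :- σ :* con 1ℤ)) refl σ) σ*0≡σ*1)

    -- Were k nonzero, B = A k (from Z) would force A (R σ) k = - (1 + k) for every σ ≢ 0.
    Λ-origin : Λ 0# 0# z ≡ 0#
    Λ-origin = decidable-stable (k ≟ 0#) λ k≢0 →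
      d₁≢d₂ (A-R-injective (*-cancelʳ k≢0 (trans (A*k≡ k≢0 d₁≢c) (sym (A*k≡ k≢0 d₂≢c)))))
      where
      open TwoAvoiding (twoAvoiding 3<q 0# 0#)
      k = Λ 0# 0# z
      A*k≡ : k ≢ 0# → ∀ {σ} → σ ≢ 0# → A (R σ) * k ≡ - (1# + k)
      A*k≡ k≢0 {σ} σ≢0 = linearCombination₁ 1#
          (solve 2 (λ a k → a :* k :- (:- (con 1ℤ :+ k)) := con 1ℤ :* ((con 1ℤ :+ k :+ a :* k) :- con 0ℤ)) refl a k)
          (x*y≡0⇒y≡0 a≢0 (linearCombination₂ 1# (- (1# + a))
            (solve 3 (λ a b k → a :* (con 1ℤ :+ k :+ a :* k) :- con 0ℤ :=
              con 1ℤ :* ((a :+ b :+ a :* b) :- con 0ℤ) :+ (:- (con 1ℤ :+ a)) :* (b :- a :* k)) refl a b k)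
            (x*y≡0⇒y≡0 b≢0 b*h≡0) b≡a*k))
        where
        a = A (R σ)
        b = B (R σ)
        a≢0 = proj₁ (A-R≢0×B-R*h≡0 σ≢0)
        b*h≡0 = proj₂ (A-R≢0×B-R*h≡0 σ≢0)
        b≡a*k : b ≡ a * k
        b≡a*k = trans (sym (+-identityʳ b)) (B+y≡A*Λ (R~Z σ))
        b≢0 : b ≢ 0#
        b≢0 = subst (_≢ 0#) (sym b≡a*k) (*-nonzero a≢0 k≢0)

    B-R≡0 : ∀ σ → B (R σ) ≡ 0#
    B-R≡0 σ = begin
      B (R σ)                ≡⟨ +-identityʳ (B (R σ)) ⟨
      B (R σ) + 0#           ≡⟨ B+y≡A*Λ (R~Z σ) ⟩
      A (R σ) * Λ 0# 0# z    ≡⟨ cong (A (R σ) *_) Λ-origin ⟩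
      A (R σ) * 0#           ≡⟨ zeroʳ (A (R σ)) ⟩
      0#                     ∎
      where open ≡-Reasoning

    y≡A*Λ : ∀ {σ t y} → σ * t ≡ y → y ≡ A (R σ) * Λ t y z
    y≡A*Λ {σ} {t} {y} σt≡y = begin
      y                      ≡⟨ +-identityˡ y ⟨
      0# + y                 ≡⟨ cong (_+ y) (B-R≡0 σ) ⟨
      B (R σ) + y            ≡⟨ B+y≡A*Λ (R~line σt≡y) ⟩
      A (R σ) * Λ t y z      ∎
      where open ≡-Reasoning

    Λ≡0⇒y≡0 : ∀ {t y} → t ≢ 0# → Λ t y z ≡ 0# → y ≡ 0#
    Λ≡0⇒y≡0 {t} {y} t≢0 Λ≡0 = begin
      y                          ≡⟨ y≡A*Λ (divide-* y t t≢0) ⟩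
      A (R σ) * Λ t y z          ≡⟨ cong (A (R σ) *_) Λ≡0 ⟩
      A (R σ) * 0#               ≡⟨ zeroʳ (A (R σ)) ⟩
      0#                         ∎
      where
      σ = divide y t t≢0
      open ≡-Reasoning

    -- The lines M t through P = (s, p₂, - z) share their third coordinate z,
    -- and each of them also passes through some R σ.
    module Pivot {p₂ : F} (p₂≢0 : p₂ ≢ 0#) (1+p₂≢0 : 1# + p₂ ≢ 0#) where

      s : F
      s = divide (- p₂) (1# + p₂) 1+p₂≢0

      s*[1+p₂]≡-p₂ : s * (1# + p₂) ≡ - p₂
      s*[1+p₂]≡-p₂ = divide-* (- p₂) (1# + p₂) 1+p₂≢0

      s≢0 : s ≢ 0#
      s≢0 = x*y≢0⇒x≢0 (subst (_≢ 0#) (sym s*[1+p₂]≡-p₂) (p₂≢0 ∘ -x≡0⇒x≡0))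

      P : Point
      P = s , p₂ , - z

      M : F → Line
      M t = t , s * t - p₂ , z

      -- s + p₂ + s p₂ = 0 makes the third incidence equation independent of t.
      P~M : ∀ t → Incident P (M t)
      P~M t =
        y+[x-y]≡x (s * t) p₂ ,
        trans (solve 4 (λ s p t z → :- z :+ z := s :* p :* t :* con 0ℤ) refl s p₂ t z) (cong (s * p₂ * t *_) (sym h≡0))
        where
        h≡0 : s + p₂ + s * p₂ ≡ 0#
        h≡0 = linearCombination₁ 1#
          (solve 2 (λ s p → s :+ p :+ s :* p :- con 0ℤ := con 1ℤ :* (s :* (con 1ℤ :+ p) :- :- p)) refl s p₂)
          s*[1+p₂]≡-p₂

      a = A P
      b = B P

      b+y≡a*Λ : ∀ t → b + (s * t - p₂) ≡ a * Λ t (s * t - p₂) z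
      b+y≡a*Λ t = B+y≡A*Λ (P~M t)

      a≢0×b*h≡0 : a ≢ 0# × b * (a + b + a * b) ≡ 0#
      a≢0×b*h≡0 = sharedPoint-equal-z (φ-incident (P~M 0#)) (φ-incident (P~M 1#))
        λ y₀≡y₁ → s≢0 (linearCombination₁ (- 1#)
          (solve 2 (λ s p → s :- con 0ℤ := (:- con 1ℤ) :* ((s :* con 0ℤ :- p) :- (s :* con 1ℤ :- p))) refl s p₂) y₀≡y₁)

      meet : ∀ {σ} → σ ≢ s → ∃[ t ] t ≢ 0# × σ * t ≡ s * t - p₂
      meet {σ} σ≢s = t , t≢0 , linearCombination₁ (- 1#)
          (solve 4 (λ σ s t p → σ :* t :- (s :* t :- p) := (:- con 1ℤ) :* ((s :- σ) :* t :- p)) refl σ s t p₂) [s-σ]*t≡p₂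
        where
        s-σ≢0 = x≢y⇒x-y≢0 (σ≢s ∘ sym)
        t = divide p₂ (s - σ) s-σ≢0
        [s-σ]*t≡p₂ : (s - σ) * t ≡ p₂
        [s-σ]*t≡p₂ = *-divide p₂ (s - σ) s-σ≢0
        t≢0 = x*y≢0⇒y≢0 (subst (_≢ 0#) (sym [s-σ]*t≡p₂) p₂≢0)

      A-R≡a : b ≡ 0# → ∀ {σ t} → σ ≢ 0# → t ≢ 0# → σ * t ≡ s * t - p₂ → A (R σ) ≡ a
      A-R≡a b≡0 {σ} {t} σ≢0 t≢0 σt≡y = *-cancelʳ Λ≢0 (trans (sym (y≡A*Λ σt≡y)) y≡a*Λ)
        where
        y = s * t - p₂
        y≡a*Λ : y ≡ a * Λ t y z
        y≡a*Λ = trans (sym (+-identityˡ y)) (trans (cong (_+ y) (sym b≡0)) (b+y≡a*Λ t))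
        Λ≢0 : Λ t y z ≢ 0#
        Λ≢0 = *-nonzero σ≢0 t≢0 ∘ trans σt≡y ∘ Λ≡0⇒y≡0 t≢0

      b≢0 : b ≢ 0#
      b≢0 b≡0 = d₁≢d₂ (A-R-injective (trans (A-R≡a′ d₁≢c d₁≢c') (sym (A-R≡a′ d₂≢c d₂≢c'))))
        where
        open TwoAvoiding (twoAvoiding 3<q 0# s)
        A-R≡a′ : ∀ {σ} → σ ≢ 0# → σ ≢ s → A (R σ) ≡ a
        A-R≡a′ σ≢0 σ≢s = let t , t≢0 , σt≡y = meet σ≢s in A-R≡a b≡0 σ≢0 t≢0 σt≡y

      -- Otherwise the line M t₁ with s t₁ - p₂ = - b would have Λ = 0.
      b≢p₂⇒b≡0 : b ≢ p₂ → b ≡ 0#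
      b≢p₂⇒b≡0 b≢p₂ = linearCombination₂ (- 1#) 1#
          (solve 3 (λ b p x → b :- con 0ℤ := (:- con 1ℤ) :* ((x :- p) :- con 0ℤ) :+ con 1ℤ :* (x :- (p :- b)))
            refl b p₂ (s * t₁))
          (Λ≡0⇒y≡0 t₁≢0 Λ≡0) s*t₁≡p₂-b
        where
        t₁ = divide (p₂ - b) s s≢0
        s*t₁≡p₂-b : s * t₁ ≡ p₂ - b
        s*t₁≡p₂-b = *-divide (p₂ - b) s s≢0
        t₁≢0 = x*y≢0⇒y≢0 (subst (_≢ 0#) (sym s*t₁≡p₂-b) (x≢y⇒x-y≢0 (b≢p₂ ∘ sym)))
        Λ≡0 : Λ t₁ (s * t₁ - p₂) z ≡ 0#
        Λ≡0 = x*y≡0⇒y≡0 (proj₁ a≢0×b*h≡0) (trans (sym (b+y≡a*Λ t₁)) (linearCombination₁ 1#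
          (solve 3 (λ b p x → b :+ (x :- p) :- con 0ℤ := con 1ℤ :* (x :- (p :- b))) refl b p₂ (s * t₁)) s*t₁≡p₂-b))

      b≡p₂ : b ≡ p₂
      b≡p₂ = decidable-stable (b ≟ p₂) (b≢0 ∘ b≢p₂⇒b≡0)

      a≡s : a ≡ s
      a≡s = *-cancelʳ 1+p₂≢0 (trans a*[1+p₂]≡-p₂ (sym s*[1+p₂]≡-p₂))
        where
        a*[1+p₂]≡-p₂ : a * (1# + p₂) ≡ - p₂
        a*[1+p₂]≡-p₂ = linearCombination₂ 1# (- (1# + a))
          (solve 3 (λ a b p → a :* (con 1ℤ :+ p) :- (:- p) :=
            con 1ℤ :* ((a :+ b :+ a :* b) :- con 0ℤ) :+ (:- (con 1ℤ :+ a)) :* (b :- p)) refl a b p₂)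
          (x*y≡0⇒y≡0 b≢0 (proj₂ a≢0×b*h≡0)) b≡p₂

      Λ-M≡t : ∀ t → Λ t (s * t - p₂) z ≡ t
      Λ-M≡t t = *-cancelˡ s≢0 (begin
        s * Λ t (s * t - p₂) z   ≡⟨ cong (_* Λ t (s * t - p₂) z) a≡s ⟨
        a * Λ t (s * t - p₂) z   ≡⟨ b+y≡a*Λ t ⟨
        b + (s * t - p₂)         ≡⟨ cong (_+ (s * t - p₂)) b≡p₂ ⟩
        p₂ + (s * t - p₂)        ≡⟨ y+[x-y]≡x (s * t) p₂ ⟩
        s * t                    ∎)
        where open ≡-Reasoning

      A-R≡σ : ∀ {σ} → σ ≢ s → A (R σ) ≡ σ
      A-R≡σ {σ} σ≢s = let t , t≢0 , σt≡y = meet σ≢s in sym (*-cancelʳ t≢0 (begin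
        σ * t                    ≡⟨ σt≡y ⟩
        s * t - p₂               ≡⟨ y≡A*Λ σt≡y ⟩
        A (R σ) * Λ t _ z        ≡⟨ cong (A (R σ) *_) (Λ-M≡t t) ⟩
        A (R σ) * t              ∎))
        where open ≡-Reasoning

    A-R≡σ : ∀ σ → A (R σ) ≡ σ
    A-R≡σ σ = byCases (σ ≟ S₁.s)
      where
      open TwoAvoiding (twoAvoiding 3<q 0# (- 1#))
      module S₁ = Pivot d₁≢c (1+x≢0 d₁≢c')
      module S₂ = Pivot d₂≢c (1+x≢0 d₂≢c')
      s₁≢s₂ : S₁.s ≢ S₂.s
      s₁≢s₂ s₁≡s₂ = d₁≢d₂ (x*[1+y]≡-y-injective
        (subst (λ s → s * (1# + d₁) ≡ - d₁) s₁≡s₂ S₁.s*[1+p₂]≡-p₂) S₂.s*[1+p₂]≡-p₂)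
      byCases : Dec (σ ≡ S₁.s) → A (R σ) ≡ σ
      byCases (yes σ≡s₁) = S₂.A-R≡σ (s₁≢s₂ ∘ trans (sym σ≡s₁))
      byCases (no  σ≢s₁) = S₁.A-R≡σ σ≢s₁

    Λ≡x : ∀ {x y} → x ≢ 0# → y ≢ 0# → Λ x y z ≡ x
    Λ≡x {x} {y} x≢0 y≢0 = *-cancelˡ σ≢0 (begin
      σ * Λ x y z              ≡⟨ cong (_* Λ x y z) (A-R≡σ σ) ⟨
      A (R σ) * Λ x y z        ≡⟨ y≡A*Λ σx≡y ⟨
      y                        ≡⟨ σx≡y ⟨
      σ * x                    ∎)
      where
      open ≡-Reasoning
      σ = divide y x x≢0
      σx≡y : σ * x ≡ y
      σx≡y = divide-* y x x≢0
      σ≢0 = x*y≢0⇒x≢0 (subst (_≢ 0#) (sym σx≡y) y≢0)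

  A≡p₁×B≡p₂ : ∀ {p₁ p₂} p₃ → p₁ ≢ 0# → p₂ ≢ 0# → A (p₁ , p₂ , p₃) ≡ p₁ × B (p₁ , p₂ , p₃) ≡ p₂
  A≡p₁×B≡p₂ {p₁} {p₂} p₃ p₁≢0 p₂≢0 = A≡p₁ , B≡p₂
    where
    P = p₁ , p₂ , p₃
    c = divide p₂ p₁ p₁≢0
    open TwoAvoiding (twoAvoiding 3<q 0# c)
    B+y≡A*t : ∀ {t} → t ≢ 0# → t ≢ c → B P + (p₁ * t - p₂) ≡ A P * t
    B+y≡A*t {t} t≢0 t≢c = trans (B+y≡A*Λ (lineThrough-incident P t)) (cong (A P *_) (Column.Λ≡x _ t≢0 y≢0))
      where
      y≢0 : p₁ * t - p₂ ≢ 0#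
      y≢0 y≡0 = t≢c (*-cancelˡ p₁≢0 (trans (x-y≡0⇒x≡y y≡0) (sym (*-divide p₂ p₁ p₁≢0))))
    A≡p₁ : A P ≡ p₁
    A≡p₁ = x-y≡0⇒x≡y (x*y≡0⇒y≡0 (d₁≢d₂ ∘ x-y≡0⇒x≡y) (linearCombination₂ (- 1#) 1#
      (solve 6 (λ a b p₁ p₂ d₁ d₂ → (d₁ :- d₂) :* (a :- p₁) :- con 0ℤ :=
        (:- con 1ℤ) :* ((b :+ (p₁ :* d₁ :- p₂)) :- a :* d₁) :+ con 1ℤ :* ((b :+ (p₁ :* d₂ :- p₂)) :- a :* d₂))
        refl (A P) (B P) p₁ p₂ d₁ d₂)
      (B+y≡A*t d₁≢c d₁≢c') (B+y≡A*t d₂≢c d₂≢c')))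
    B≡p₂ : B P ≡ p₂
    B≡p₂ = linearCombination₂ 1# d₁
      (solve 5 (λ a b p₁ p₂ d → b :- p₂ := con 1ℤ :* ((b :+ (p₁ :* d :- p₂)) :- a :* d) :+ d :* (a :- p₁))
        refl (A P) (B P) p₁ p₂ d₁)
      (B+y≡A*t d₁≢c d₁≢c') A≡p₁

  Λ≡x-offDiagonal : ∀ {x y z} → x ≢ y → Λ x y z ≡ x
  Λ≡x-offDiagonal {x} {y} {z} x≢y = *-cancelˡ 1≢0 (begin
    1# * Λ x y z          ≡⟨ cong (_* Λ x y z) A≡1 ⟨
    A Q * Λ x y z         ≡⟨ B+y≡A*Λ Q~L ⟨
    B Q + y               ≡⟨ cong (_+ y) B≡q₂ ⟩
    (1# * x - y) + y      ≡⟨ proj₁ Q~L ⟩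
    1# * x                ∎)
    where
    open ≡-Reasoning
    Q = pointOn (x , y , z) 1#
    Q~L = pointOn-incident (x , y , z) 1#
    q₂≢0 : 1# * x - y ≢ 0#
    q₂≢0 q₂≡0 = x≢y (linearCombination₁ 1#
      (solve 2 (λ x y → x :- y := con 1ℤ :* ((con 1ℤ :* x :- y) :- con 0ℤ)) refl x y) q₂≡0)
    A≡1 = proj₁ (A≡p₁×B≡p₂ _ 1≢0 q₂≢0)
    B≡q₂ = proj₂ (A≡p₁×B≡p₂ _ 1≢0 q₂≢0)

  Λ≡x : ∀ x y z → Λ x y z ≡ x
  Λ≡x x y z with x ≟ y | x ≟ 0#
  ... | no  x≢y  | _        = Λ≡x-offDiagonal x≢y
  ... | yes refl | yes refl = Column.Λ-origin z
  ... | yes refl | no  x≢0  = Column.Λ≡x z x≢0 x≢0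

  A≡p₁ : ∀ p₁ p₂ p₃ → A (p₁ , p₂ , p₃) ≡ p₁
  A≡p₁ p₁ p₂ p₃ = byCases (p₁ ≟ 0#) (p₂ ≟ 0#)
    where
    byCases : Dec (p₁ ≡ 0#) → Dec (p₂ ≡ 0#) → A (p₁ , p₂ , p₃) ≡ p₁
    byCases (yes refl) _          = A-firstZero p₂ p₃
    byCases (no  p₁≢0) (yes refl) = subst (λ w → A (p₁ , 0# , w) ≡ p₁) (-‿involutive p₃) (Column.A-R≡σ (- p₃) p₁)
    byCases (no  p₁≢0) (no  p₂≢0) = proj₁ (A≡p₁×B≡p₂ p₃ p₁≢0 p₂≢0)

3<q : ∀ {q} → OddPrimePower q → q % 3 ≡ 1 → 3 ℕ.< q
3<q {0} (p , k , p-prime , _ , _ , 0≡p^k) _ = contradiction (subst Prime (ℕ.m^n≡0⇒m≡0 p k (sym 0≡p^k)) p-prime) ¬prime[0]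
3<q {1} (p , k , p-prime , _ , k≥1 , 1≡p^k) _ with ℕ.m^n≡1⇒n≡0∨m≡1 p k (sym 1≡p^k)
... | inj₁ refl = contradiction k≥1 λ ()
... | inj₂ refl = contradiction p-prime ¬prime[1]
3<q {2} _ ()
3<q {3} _ ()
3<q {suc (suc (suc (suc q)))} _ _ = s≤s (s≤s (s≤s (s≤s z≤n)))

lemma4p10 : (q : ℕ) → OddPrimePower q → q % 3 ≡ 1 → (𝔽 : FiniteField q) →
    let open Graph 𝔽 in
    (φ : Automorphism) (λ₁ : FiniteField.F 𝔽 → FiniteField.F 𝔽 → FiniteField.F 𝔽 → FiniteField.F 𝔽) (λ₂ λ₃ : FiniteField.F 𝔽 → FiniteField.F 𝔽) →
    (∀ x y z → apply φ (inj₂ (x , y , z)) ≡ inj₂ (λ₁ x y z , λ₂ y , λ₃ z)) →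
    (∀ a → λ₂ a ≡ a) →
    ∀ x y z →
      (∃[ l ] (apply φ (inj₂ (x , y , z)) ≡ inj₂ l × proj₁ l ≡ x)) ×
      (∃[ p ] (apply φ (inj₁ (x , y , z)) ≡ inj₁ p × proj₁ p ≡ x))
lemma4p10 q q-oddPrimePower q%3≡1 𝔽 φ λ₁ λ₂ λ₃ φ-line λ₂≗id x y z =
  ((λ₁ x y z , λ₂ y , λ₃ z) , φ-line x y z , Λ≡x x y z) ,
  (φᴾ (x , y , z) , proj₂ (φ-point (x , y , z)) , A≡p₁ x y z)
  where
  open Rigidity 𝔽 (3<q q-oddPrimePower q%3≡1) φ λ₁ λ₃
    (λ x y z → trans (φ-line x y z) (cong (λ y′ → inj₂ (λ₁ x y z , y′ , λ₃ z)) (λ₂≗id y)))
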